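{- Let $A$ be a good $s$-balancer and let $c\in\mathbb{N}$. The potential $\phi_t(c)=\sum_{v\in V}\max\{x_t(v)-c\,d^+,0\}$ is non-increasing in $t$ and satisfies $\phi_t(c)\le\phi_{t-1}(c)-\sum_{u\in V}\Delta_t(c,u)$, where $\Delta_t(c,u)=\min\{x_{t-1}(u),c d^++s\}-\max\{x_t(u),c d^+\}$ if $x_{t-1}(u)>x_t(u)$, $x_{t-1}(u)>c d^+$ and $x_t(u)<c d^++s$, and $\Delta_t(c,u)=0$ otherwise.
   Context: Model: $G=(V,E)$ is a $d$-regular graph (symmetric directed); $G^+$ adds $d^{\circ}$ self-loops per node, $d^+=d+d^{\circ}$; $E_u$ denotes the original edges out of $u$ and $E_u^+$ these together with the self-loops of $u$. $x_t(u)$ is the number of indivisible tokens at $u$ at the beginning of synchronous step $t$; in step $t$ node $u$ sends all tokens over $E_u^+$, $f_t(e)$ over edge $e$, and its new load is the number of tokens arriving. $F_t(e)=\sum_{\tau\le t}f_\tau(e)$. Good $s$-balancer ($1\le s\le d^{\circ}$): for all $t,u$, every edge of $E_u^+$ receives at least $\lfloor x_t(u)/d^+\rfloor$ tokens, and the remaining $e(u)=x_t(u)-d^+\lfloor x_t(u)/d^+\rfloor$ tokens are distributed so that (1) for any $e_1,e_2\in E_u$, $|F_t(e_1)-F_t(e_2)|\le 1$; (2) at least $\min\{s,e(u)\}$ self-loops of $u$ receive $\lceil x_t(u)/d^+\rceil$ tokens; (3) every edge of $E_u^+$ receives at most $\lceil x_t(u)/d^+\rceil$ tokens. -}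

module Defs where

open import Data.Nat using (ℕ; zero; suc; _+_; _*_; _∸_; _≤_; _<_; _⊓_; _⊔_)
open import Data.Nat.DivMod using (_/_)
open import Data.Nat.Properties using (_≟_; _<?_)
open import Data.Fin using (Fin; zero; suc; _↑ˡ_; _↑ʳ_)
open import Data.Bool using (Bool; true; false; if_then_else_; _∧_)
open import Data.Product using (_×_)
open import Relation.Nullary using (¬_)
open import Relation.Nullary.Decidable using (⌊_⌋)
open import Relation.Binary.PropositionalEquality using (_≡_)

sumF : ∀ {m} → (Fin m → ℕ) → ℕ
sumF {zero}  g = 0
sumF {suc m} g = g zero + sumF (λ i → g (suc i))

countF : ∀ {m} → (Fin m → Bool) → ℕ
countF {zero}  p = 0
countF {suc m} p = (if p zero then 1 else 0) + countF (λ i → p (suc i))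

-- Floor and ceiling division (the divisor is never 0 in our use; 0 is a dummy value).
floorDiv : ℕ → ℕ → ℕ
floorDiv x zero    = 0
floorDiv x (suc m) = x / suc m

ceilDiv : ℕ → ℕ → ℕ
ceilDiv x zero    = 0
ceilDiv x (suc m) = (x + m) / suc m

-- A d-regular simple symmetric directed graph on nodes Fin n.
-- The out-edges of u are indexed by i : Fin d, going to nb u i; the reverse
-- edge of (u, i) is the edge (nb u i, rev u i).
record Graph (n d : ℕ) : Set where
  field
    nb      : Fin n → Fin d → Fin n
    rev     : Fin n → Fin d → Fin d
    nb-rev  : ∀ u i → nb (nb u i) (rev u i) ≡ u
    rev-rev : ∀ u i → rev (nb u i) (rev u i) ≡ i
    nb-inj  : ∀ u i j → nb u i ≡ nb u j → i ≡ j
    no-loop : ∀ u i → ¬ (nb u i ≡ u)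

module _ {n d : ℕ} (G : Graph n d) (d° : ℕ) where
  open Graph G

  d⁺ : ℕ
  d⁺ = d + d°

  -- In G⁺, the edges out of u are indexed by Fin (d + d°):
  -- j ↑ˡ d° (j : Fin d) is the original edge (u, nb u j),
  -- d ↑ʳ k (k : Fin d°) is the k-th self-loop of u.
  orig : Fin d → Fin (d + d°)
  orig i = i ↑ˡ d°

  loop : Fin d° → Fin (d + d°)
  loop k = d ↑ʳ k

  -- x t u : load of u at the beginning of step t;
  -- f t u e : number of tokens sent in step t by u over its edge e ∈ E⁺_u.
  -- Step t maps x t to x (suc t).
  IsProcess : (ℕ → Fin n → ℕ) → (ℕ → Fin n → Fin (d + d°) → ℕ) → Set
  IsProcess x f =
    (∀ t u → sumF (f t u) ≡ x t u) ×
    (∀ t v → x (suc t) v ≡ sumF (λ k → f t v (loop k))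
                           + sumF (λ i → f t (nb v i) (orig (rev v i))))

  cumF : (ℕ → Fin n → Fin (d + d°) → ℕ) → ℕ → Fin n → Fin (d + d°) → ℕ
  cumF f zero    u e = f zero u e
  cumF f (suc t) u e = cumF f t u e + f (suc t) u e

  GoodBalancer : ℕ → (ℕ → Fin n → ℕ) → (ℕ → Fin n → Fin (d + d°) → ℕ) → Set
  GoodBalancer s x f =
    (∀ t u e → floorDiv (x t u) d⁺ ≤ f t u e) ×
    (∀ t u i j → cumF f t u (orig i) ≤ suc (cumF f t u (orig j))) ×
    (∀ t u → (s ⊓ (x t u ∸ d⁺ * floorDiv (x t u) d⁺))
             ≤ countF (λ k → ⌊ f t u (loop k) ≟ ceilDiv (x t u) d⁺ ⌋)) ×
    (∀ t u e → f t u e ≤ ceilDiv (x t u) d⁺)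

  φ : (ℕ → Fin n → ℕ) → ℕ → ℕ → ℕ
  φ x t c = sumF (λ v → x t v ∸ c * d⁺)

  -- Δ for the step from x t to x (suc t) (the paper's Δ_{t+1}(c,u)).
  Δ : ℕ → (ℕ → Fin n → ℕ) → ℕ → ℕ → Fin n → ℕ
  Δ s x t c u =
    if ⌊ x (suc t) u <? x t u ⌋ ∧ ⌊ c * d⁺ <? x t u ⌋ ∧ ⌊ x (suc t) u <? c * d⁺ + s ⌋
    then (x t u ⊓ (c * d⁺ + s)) ∸ (x (suc t) u ⊔ c * d⁺)
    else 0

module Submission where

-- Call f ∸ c the *excess* of a flow f over an edge.  Two facts about the
-- tokens sent by a node u with load x over its d⁺ edges drive the proof:
--   * balanced sending: every edge gets ⌊x/d⁺⌋ or ⌈x/d⁺⌉ tokens, so either all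
--     edges carry at least c tokens or none carries more than c; in both cases
--     the total outgoing excess is exactly x ∸ c d⁺;
--   * self-loops: if x > c d⁺, the self-loops of u alone carry excess at least
--     min{x − c d⁺, s} (all d° ≥ s loops exceed c, or at least min{s, e(u)}
--     of them carry the ceiling, which exceeds c).
-- On the receiving side, the new load x' of v is a sum of d⁺ flows, so
-- x' ∸ c d⁺ is at most the incoming excess of v; together with the self-loop
-- bound this gives Δ(c,v) + (x' ∸ c d⁺) ≤ incoming excess of v.  Summing over
-- v and reindexing the incoming edges by edge reversal, the total incoming
-- excess is the total outgoing excess, i.e. φ_t(c).

open import Defs
open import Data.Nat using (ℕ; zero; suc; _+_; _*_; _∸_; _≤_; _<_; _⊓_; _⊔_; z≤n; s≤s⁻¹; _≤?_; _<?_)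
open import Data.Nat.Properties
open import Data.Nat.DivMod using (_/_; /-monoˡ-≤; m*n/n≡m; m<n*o⇒m/o<n)
open import Data.Fin using (Fin; zero; suc; _↑ˡ_; _↑ʳ_; combine; remQuot)
open import Data.Fin.Properties using (remQuot-combine; combine-remQuot)
open import Data.Fin.Permutation using (permutation)
open import Data.Bool using (Bool; true; false; T; if_then_else_)
open import Data.Product using (_×_; _,_; proj₁; proj₂; uncurry)
open import Data.Sum using (inj₁; inj₂)
open import Relation.Nullary using (yes; no)
open import Relation.Nullary.Decidable using (⌊_⌋; toWitness)
open import Relation.Binary.PropositionalEquality
open import Function using (_∘_)
import Algebra.Properties.CommutativeMonoid.Sum as MonoidSum
open import Algebra.Properties.CommutativeSemigroup +-commutativeSemigroup using (interchange)

sumF-cong : ∀ {m} {g h : Fin m → ℕ} → (∀ i → g i ≡ h i) → sumF g ≡ sumF h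
sumF-cong {zero}  e = refl
sumF-cong {suc m} e = cong₂ _+_ (e zero) (sumF-cong (e ∘ suc))

sumF-mono : ∀ {m} {g h : Fin m → ℕ} → (∀ i → g i ≤ h i) → sumF g ≤ sumF h
sumF-mono {zero}  e = z≤n
sumF-mono {suc m} e = +-mono-≤ (e zero) (sumF-mono (e ∘ suc))

sumF-+ : ∀ {m} (g h : Fin m → ℕ) → sumF (λ i → g i + h i) ≡ sumF g + sumF h
sumF-+ {zero}  g h = refl
sumF-+ {suc m} g h =
  trans (cong (g zero + h zero +_) (sumF-+ (g ∘ suc) (h ∘ suc)))
        (interchange (g zero) (h zero) _ _)

sumF-zero : ∀ m → sumF {m} (λ _ → 0) ≡ 0
sumF-zero zero    = refl
sumF-zero (suc m) = sumF-zero m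

sumF-split : ∀ a b (h : Fin (a + b) → ℕ) →
  sumF h ≡ sumF (λ i → h (i ↑ˡ b)) + sumF (λ j → h (a ↑ʳ j))
sumF-split zero    b h = refl
sumF-split (suc a) b h =
  trans (cong (h zero +_) (sumF-split a b (h ∘ suc))) (sym (+-assoc (h zero) _ _))

sumF-combine : ∀ n d (g : Fin (n * d) → ℕ) →
  sumF g ≡ sumF (λ (v : Fin n) → sumF (λ (i : Fin d) → g (combine v i)))
sumF-combine zero    d g = refl
sumF-combine (suc n) d g =
  trans (sumF-split d (n * d) g)
        (cong (sumF (λ i → g (i ↑ˡ (n * d))) +_) (sumF-combine n d (λ k → g (d ↑ʳ k))))

-- The library's sums over Fin for (ℕ, +, 0), which carry the permutation lemma;
-- sumF coincides with them.
module ℕSum = MonoidSum +-0-commutativeMonoid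

sumF≡sum : ∀ {m} (g : Fin m → ℕ) → sumF g ≡ ℕSum.sum g
sumF≡sum {zero}  g = refl
sumF≡sum {suc m} g = cong (g zero +_) (sumF≡sum (g ∘ suc))

sumF-involution : ∀ {N} (π : Fin N → Fin N) → (∀ i → π (π i) ≡ i) → (g : Fin N → ℕ) →
  sumF (g ∘ π) ≡ sumF g
sumF-involution π inv g = begin
  sumF (g ∘ π)        ≡⟨ sumF≡sum (g ∘ π) ⟩
  ℕSum.sum (g ∘ π)    ≡⟨ ℕSum.sum-permute g (permutation π π inv inv) ⟨
  ℕSum.sum g          ≡⟨ sumF≡sum g ⟨
  sumF g              ∎
  where open ≡-Reasoning

sumF-pair-involution : ∀ n d (σ₁ : Fin n → Fin d → Fin n) (σ₂ : Fin n → Fin d → Fin d) →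
  (∀ v i → σ₁ (σ₁ v i) (σ₂ v i) ≡ v) → (∀ v i → σ₂ (σ₁ v i) (σ₂ v i) ≡ i) →
  (h : Fin n → Fin d → ℕ) →
  sumF (λ v → sumF (λ i → h (σ₁ v i) (σ₂ v i))) ≡ sumF (λ v → sumF (λ i → h v i))
sumF-pair-involution n d σ₁ σ₂ inv₁ inv₂ h = begin
  sumF (λ v → sumF (λ i → h (σ₁ v i) (σ₂ v i)))
    ≡⟨ sumF-cong (λ v → sumF-cong (λ i → sym (decode-π v i))) ⟩
  sumF (λ (v : Fin n) → sumF (λ (i : Fin d) → H (π (combine v i))))
    ≡⟨ sumF-combine n d (H ∘ π) ⟨
  sumF (H ∘ π)
    ≡⟨ sumF-involution π π-involutive H ⟩
  sumF H
    ≡⟨ sumF-combine n d H ⟩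
  sumF (λ (v : Fin n) → sumF (λ (i : Fin d) → H (combine v i)))
    ≡⟨ sumF-cong (λ v → sumF-cong (λ i → decode v i)) ⟩
  sumF (λ v → sumF (λ i → h v i)) ∎
  where
  open ≡-Reasoning
  σ : Fin n × Fin d → Fin n × Fin d
  σ (v , i) = σ₁ v i , σ₂ v i
  H : Fin (n * d) → ℕ
  H k = uncurry h (remQuot d k)
  π : Fin (n * d) → Fin (n * d)
  π k = uncurry combine (σ (remQuot d k))
  π-involutive : ∀ k → π (π k) ≡ k
  π-involutive k = begin
    uncurry combine (σ (remQuot {n} d (π k)))  ≡⟨ cong (uncurry combine ∘ σ) (remQuot-combine {n} {d} _ _) ⟩
    uncurry combine (σ (σ (remQuot {n} d k)))  ≡⟨ cong (uncurry combine) (cong₂ _,_ (inv₁ _ _) (inv₂ _ _)) ⟩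
    uncurry combine (remQuot {n} d k)          ≡⟨ combine-remQuot {n} d k ⟩
    k                                      ∎
  decode : ∀ v i → H (combine v i) ≡ h v i
  decode v i = cong (uncurry h) (remQuot-combine {n} {d} v i)
  decode-π : ∀ v i → H (π (combine v i)) ≡ h (σ₁ v i) (σ₂ v i)
  decode-π v i = trans (cong (H ∘ uncurry combine ∘ σ) (remQuot-combine {n} {d} v i))
                       (decode (σ₁ v i) (σ₂ v i))

countF-all : ∀ m → countF {m} (λ _ → true) ≡ m
countF-all zero    = refl
countF-all (suc m) = cong suc (countF-all m)

≤-floorDiv : ∀ {D} c x → 1 ≤ D → c * D ≤ x → c ≤ floorDiv x D
≤-floorDiv {suc m} c x _ cD≤x =
  subst (_≤ x / suc m) (m*n/n≡m c (suc m)) (/-monoˡ-≤ (suc m) cD≤x)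

ceilDiv-≤ : ∀ {D} c x → 1 ≤ D → x < c * D → ceilDiv x D ≤ c
ceilDiv-≤ {suc m} c x _ x<cD = s≤s⁻¹ (m<n*o⇒m/o<n {x + m} {suc c} {suc m} (begin-strict
  x + m              <⟨ +-monoˡ-< m x<cD ⟩
  c * suc m + m      <⟨ +-monoʳ-< (c * suc m) (n<1+n m) ⟩
  c * suc m + suc m  ≡⟨ +-comm (c * suc m) (suc m) ⟩
  suc c * suc m      ∎))
  where open ≤-Reasoning

<-ceilDiv : ∀ {D} c x → 1 ≤ D → c * D < x → c < ceilDiv x D
<-ceilDiv {suc m} c x _ cD<x =
  subst (_≤ (x + m) / suc m) (m*n/n≡m (suc c) (suc m)) (/-monoˡ-≤ (suc m) (begin
    suc c * suc m      ≡⟨ +-comm (suc m) (c * suc m) ⟩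
    c * suc m + suc m  ≡⟨ +-suc (c * suc m) m ⟩
    suc (c * suc m) + m ≤⟨ +-monoˡ-≤ m cD<x ⟩
    x + m              ∎))
  where open ≤-Reasoning


-- Every entry is at most c plus its excess.
sumF-≤-cap+excess : ∀ {m} (a : Fin m → ℕ) c → sumF a ≤ m * c + sumF (λ k → a k ∸ c)
sumF-≤-cap+excess {zero}  a c = z≤n
sumF-≤-cap+excess {suc m} a c = begin
  a zero + sumF (a ∘ suc)
    ≤⟨ +-mono-≤ (m≤n+m∸n (a zero) c) (sumF-≤-cap+excess (a ∘ suc) c) ⟩
  (c + (a zero ∸ c)) + (m * c + sumF (λ k → a (suc k) ∸ c))
    ≡⟨ interchange c (a zero ∸ c) (m * c) _ ⟩
  (c + m * c) + ((a zero ∸ c) + sumF (λ k → a (suc k) ∸ c)) ∎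
  where open ≤-Reasoning

sumF-cap+excess : ∀ {m} (a : Fin m → ℕ) c → (∀ k → c ≤ a k) →
  m * c + sumF (λ k → a k ∸ c) ≡ sumF a
sumF-cap+excess {zero}  a c c≤a = refl
sumF-cap+excess {suc m} a c c≤a = begin
  (c + m * c) + ((a zero ∸ c) + sumF (λ k → a (suc k) ∸ c))
    ≡⟨ interchange c (m * c) (a zero ∸ c) _ ⟩
  (c + (a zero ∸ c)) + (m * c + sumF (λ k → a (suc k) ∸ c))
    ≡⟨ cong₂ _+_ (m+[n∸m]≡n (c≤a zero)) (sumF-cap+excess (a ∘ suc) c (c≤a ∘ suc)) ⟩
  a zero + sumF (a ∘ suc) ∎
  where open ≡-Reasoning

-- Each entry above c contributes at least one unit of excess.
countF-≤-excess : ∀ {m} (a : Fin m → ℕ) c (p : Fin m → Bool) → (∀ k → T (p k) → c < a k) →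
  countF p ≤ sumF (λ k → a k ∸ c)
countF-≤-excess {zero}  a c p above = z≤n
countF-≤-excess {suc m} a c p above =
  +-mono-≤ (first (p zero) (above zero)) (countF-≤-excess (a ∘ suc) c (p ∘ suc) (above ∘ suc))
  where
  first : ∀ b → (T b → c < a zero) → (if b then 1 else 0) ≤ a zero ∸ c
  first true  c<a = m<n⇒0<n∸m (c<a _)
  first false _   = z≤n

balanced-excess : ∀ {D} (a : Fin D → ℕ) c x → 1 ≤ D → sumF a ≡ x →
  (∀ e → floorDiv x D ≤ a e) → (∀ e → a e ≤ ceilDiv x D) →
  sumF (λ e → a e ∸ c) ≡ x ∸ c * D
balanced-excess {D} a c x D≥1 sum≡x floor≤ ≤ceil with c * D ≤? x
... | yes cD≤x = begin
  sumF (λ e → a e ∸ c)                   ≡⟨ m+n∸m≡n (D * c) _ ⟨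
  D * c + sumF (λ e → a e ∸ c) ∸ D * c   ≡⟨ cong₂ _∸_ (sumF-cap+excess a c c≤a) (*-comm D c) ⟩
  sumF a ∸ c * D                         ≡⟨ cong (_∸ c * D) sum≡x ⟩
  x ∸ c * D                              ∎
  where
  open ≡-Reasoning
  c≤a : ∀ e → c ≤ a e
  c≤a e = ≤-trans (≤-floorDiv c x D≥1 cD≤x) (floor≤ e)
... | no cD≰x = begin
  sumF (λ e → a e ∸ c)   ≡⟨ sumF-cong (λ e → m≤n⇒m∸n≡0 (≤-trans (≤ceil e) (ceilDiv-≤ c x D≥1 x<cD))) ⟩
  sumF {D} (λ _ → 0)     ≡⟨ sumF-zero D ⟩
  0                      ≡⟨ m≤n⇒m∸n≡0 (<⇒≤ x<cD) ⟨
  x ∸ c * D              ∎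
  where
  open ≡-Reasoning
  x<cD : x < c * D
  x<cD = ≰⇒> cD≰x

self-loop-excess : ∀ {m} (L : Fin m → ℕ) D s c x → 1 ≤ D → s ≤ m →
  (∀ k → floorDiv x D ≤ L k) →
  s ⊓ (x ∸ D * floorDiv x D) ≤ countF (λ k → ⌊ L k ≟ ceilDiv x D ⌋) →
  c * D < x → (x ∸ c * D) ⊓ s ≤ sumF (λ k → L k ∸ c)
self-loop-excess {m} L D s c x D≥1 s≤m floor≤ enough-ceil cD<x
  with c <? floorDiv x D
... | yes c<floor = begin
  (x ∸ c * D) ⊓ s                ≤⟨ m⊓n≤n _ s ⟩
  s                              ≤⟨ s≤m ⟩
  m                              ≡⟨ countF-all m ⟨
  countF {m} (λ _ → true)        ≤⟨ countF-≤-excess L c _ (λ k _ → ≤-trans c<floor (floor≤ k)) ⟩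
  sumF (λ k → L k ∸ c)           ∎
  where open ≤-Reasoning
... | no c≮floor = begin
  (x ∸ c * D) ⊓ s                  ≡⟨ ⊓-comm _ s ⟩
  s ⊓ (x ∸ c * D)                  ≤⟨ ⊓-monoʳ-≤ s (∸-monoʳ-≤ x D*floor≤cD) ⟩
  s ⊓ (x ∸ D * floorDiv x D)       ≤⟨ enough-ceil ⟩
  countF (λ k → ⌊ L k ≟ ceilDiv x D ⌋)
    ≤⟨ countF-≤-excess L c _ (λ k L≡ceil → subst (c <_) (sym (toWitness L≡ceil)) (<-ceilDiv c x D≥1 cD<x)) ⟩
  sumF (λ k → L k ∸ c)             ∎
  where
  open ≤-Reasoning
  D*floor≤cD : D * floorDiv x D ≤ c * D
  D*floor≤cD = subst (D * floorDiv x D ≤_) (*-comm D c) (*-monoʳ-≤ D (≮⇒≥ c≮floor))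

if-≤ : ∀ {b : Bool} {y : ℕ} → (if b then y else 0) ≤ y
if-≤ {true}  = ≤-refl
if-≤ {false} = z≤n

⊓-shift : ∀ x C s → x ⊓ (C + s) ≤ C + ((x ∸ C) ⊓ s)
⊓-shift x C s = begin
  x ⊓ (C + s)                  ≤⟨ ⊓-monoˡ-≤ (C + s) (m≤n+m∸n x C) ⟩
  (C + (x ∸ C)) ⊓ (C + s)      ≡⟨ +-distribˡ-⊓ C (x ∸ C) s ⟨
  C + ((x ∸ C) ⊓ s)            ∎
  where open ≤-Reasoning

⊔≡+∸ : ∀ X C → X ⊔ C ≡ C + (X ∸ C)
⊔≡+∸ X C with ≤-total X C
... | inj₁ X≤C = begin
  X ⊔ C          ≡⟨ m≤n⇒m⊔n≡n X≤C ⟩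
  C              ≡⟨ +-identityʳ C ⟨
  C + 0          ≡⟨ cong (C +_) (m≤n⇒m∸n≡0 X≤C) ⟨
  C + (X ∸ C)    ∎
  where open ≡-Reasoning
... | inj₂ C≤X = trans (m≥n⇒m⊔n≡m C≤X) (sym (m+[n∸m]≡n C≤X))

∸-⊔-shift : ∀ X C k → (C + k) ∸ (X ⊔ C) ≡ k ∸ (X ∸ C)
∸-⊔-shift X C k = trans (cong ((C + k) ∸_) (⊔≡+∸ X C)) ([m+n]∸[m+o]≡n∸o C k (X ∸ C))

-- (k ∸ Y) + Y = max{k, Y}, so it is bounded by any common bound of k and Y.
∸+-≤ : ∀ {Y k S δ} → Y ≤ S → k ≤ S → δ ≤ k ∸ Y → δ + Y ≤ S
∸+-≤ {Y} {k} {S} {δ} Y≤S k≤S δ≤k∸Y with ≤-total Y k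
... | inj₁ Y≤k = begin
  δ + Y        ≤⟨ +-monoˡ-≤ Y δ≤k∸Y ⟩
  (k ∸ Y) + Y  ≡⟨ m∸n+n≡m Y≤k ⟩
  k            ≤⟨ k≤S ⟩
  S            ∎
  where open ≤-Reasoning
... | inj₂ k≤Y = begin
  δ + Y        ≡⟨ cong (_+ Y) (n≤0⇒n≡0 (≤-trans δ≤k∸Y (≤-reflexive (m≤n⇒m∸n≡0 k≤Y)))) ⟩
  Y            ≤⟨ Y≤S ⟩
  S            ∎
  where open ≤-Reasoning

module OneStep {n d : ℕ} (G : Graph n d) (d° s : ℕ) (s≥1 : 1 ≤ s) (s≤d° : s ≤ d°)
  (x : ℕ → Fin n → ℕ) (f : ℕ → Fin n → Fin (d + d°) → ℕ)
  (process : IsProcess G d° x f) (good : GoodBalancer G d° s x f) (c : ℕ) where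

  open Graph G
  D : ℕ
  D = d + d°

  C : ℕ
  C = c * D

  D≥1 : 1 ≤ D
  D≥1 = ≤-trans s≥1 (≤-trans s≤d° (m≤n+m d° d))

  -- The parts of the hypotheses that the argument uses.
  sends-load : ∀ t u → sumF (f t u) ≡ x t u
  sends-load = proj₁ process

  new-load : ∀ t v → x (suc t) v ≡ sumF (λ k → f t v (loop G d° k))
                                   + sumF (λ i → f t (nb v i) (orig G d° (rev v i)))
  new-load = proj₂ process

  floor≤ : ∀ t u e → floorDiv (x t u) D ≤ f t u e
  floor≤ = proj₁ good

  enough-ceil : ∀ t u → s ⊓ (x t u ∸ D * floorDiv (x t u) D)
                        ≤ countF (λ k → ⌊ f t u (loop G d° k) ≟ ceilDiv (x t u) D ⌋)
  enough-ceil = proj₁ (proj₂ (proj₂ good))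

  ≤ceil : ∀ t u e → f t u e ≤ ceilDiv (x t u) D
  ≤ceil = proj₂ (proj₂ (proj₂ good))

  outExcess : ℕ → Fin n → ℕ
  outExcess t u = sumF (λ e → f t u e ∸ c)

  loopExcess : ℕ → Fin n → ℕ
  loopExcess t v = sumF (λ k → f t v (loop G d° k) ∸ c)

  inExcess : ℕ → Fin n → ℕ
  inExcess t v = sumF (λ i → f t (nb v i) (orig G d° (rev v i)) ∸ c)

  outExcess≡ : ∀ t u → outExcess t u ≡ x t u ∸ C
  outExcess≡ t u = balanced-excess (f t u) c (x t u) D≥1 (sends-load t u) (floor≤ t u) (≤ceil t u)

  load-excess-≤ : ∀ t v → x (suc t) v ∸ C ≤ loopExcess t v + inExcess t v
  load-excess-≤ t v = m≤n+o⇒m∸n≤o (x (suc t) v) C (begin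
    x (suc t) v                          ≡⟨ new-load t v ⟩
    sumF L + sumF R                      ≤⟨ +-mono-≤ (sumF-≤-cap+excess L c) (sumF-≤-cap+excess R c) ⟩
    (d° * c + loopExcess t v) + (d * c + inExcess t v)
                                         ≡⟨ interchange (d° * c) _ (d * c) _ ⟩
    (d° * c + d * c) + (loopExcess t v + inExcess t v)
                                         ≡⟨ cong (_+ (loopExcess t v + inExcess t v)) caps ⟩
    C + (loopExcess t v + inExcess t v)  ∎)
    where
    open ≤-Reasoning
    L : Fin d° → ℕ
    L k = f t v (loop G d° k)
    R : Fin d → ℕ
    R i = f t (nb v i) (orig G d° (rev v i))
    caps : d° * c + d * c ≡ c * (d + d°)
    caps = trans (+-comm (d° * c) (d * c)) (trans (sym (*-distribʳ-+ c d d°)) (*-comm (d + d°) c))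

  loop-excess-≥ : ∀ t v → (x t v ∸ C) ⊓ s ≤ loopExcess t v
  loop-excess-≥ t v with C <? x t v
  ... | yes C<x = self-loop-excess (λ k → f t v (loop G d° k)) D s c (x t v) D≥1 s≤d°
                    (λ k → floor≤ t v (loop G d° k)) (enough-ceil t v) C<x
  ... | no C≮x  = ≤-trans (m⊓n≤m _ s) (≤-trans (≤-reflexive (m≤n⇒m∸n≡0 (≮⇒≥ C≮x))) z≤n)

  node-drop : ∀ t v → Δ G d° s x t c v + (x (suc t) v ∸ C) ≤ loopExcess t v + inExcess t v
  node-drop t v = ∸+-≤ (load-excess-≤ t v) (≤-trans (loop-excess-≥ t v) (m≤m+n _ _)) (begin
    Δ G d° s x t c v                      ≤⟨ if-≤ ⟩
    (x t v ⊓ (C + s)) ∸ (X' ⊔ C)          ≤⟨ ∸-monoˡ-≤ (X' ⊔ C) (⊓-shift (x t v) C s) ⟩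
    (C + ((x t v ∸ C) ⊓ s)) ∸ (X' ⊔ C)    ≡⟨ ∸-⊔-shift X' C _ ⟩
    ((x t v ∸ C) ⊓ s) ∸ (X' ∸ C)          ∎)
    where
    open ≤-Reasoning
    X' : ℕ
    X' = x (suc t) v

  -- Reversing edges, the total excess received equals the total excess sent.
  received≡sent : ∀ t → sumF (λ v → loopExcess t v + inExcess t v) ≡ sumF (outExcess t)
  received≡sent t = begin
    sumF (λ v → loopExcess t v + inExcess t v)
      ≡⟨ sumF-+ (loopExcess t) (inExcess t) ⟩
    sumF (loopExcess t) + sumF (inExcess t)
      ≡⟨ cong (sumF (loopExcess t) +_) (sumF-pair-involution n d nb rev nb-rev rev-rev origExcess) ⟩
    sumF (loopExcess t) + sumF (λ u → sumF (origExcess u))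
      ≡⟨ sumF-+ (loopExcess t) (λ u → sumF (origExcess u)) ⟨
    sumF (λ u → loopExcess t u + sumF (origExcess u))
      ≡⟨ sumF-cong (λ u → trans (+-comm (loopExcess t u) _) (sym (sumF-split d d° (λ e → f t u e ∸ c)))) ⟩
    sumF (outExcess t) ∎
    where
    open ≡-Reasoning
    origExcess : Fin n → Fin d → ℕ
    origExcess u i = f t u (orig G d° i) ∸ c

lemma2 : (n d d° s : ℕ) (G : Graph n d) →
    1 ≤ s → s ≤ d° →
    (x : ℕ → Fin n → ℕ) (f : ℕ → Fin n → Fin (d + d°) → ℕ) →
    IsProcess G d° x f → GoodBalancer G d° s x f →
    (c : ℕ) →
    (∀ t → φ G d° x (suc t) c ≤ φ G d° x t c) ×
    (∀ t → sumF (Δ G d° s x t c) + φ G d° x (suc t) c ≤ φ G d° x t c)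
lemma2 n d d° s G s≥1 s≤d° x f process good c =
  (λ t → ≤-trans (m≤n+m _ _) (drop t)) , drop
  where
  open OneStep G d° s s≥1 s≤d° x f process good c
  drop : ∀ t → sumF (Δ G d° s x t c) + φ G d° x (suc t) c ≤ φ G d° x t c
  drop t = begin
    sumF (Δ G d° s x t c) + sumF (λ v → x (suc t) v ∸ C)
      ≡⟨ sumF-+ (Δ G d° s x t c) (λ v → x (suc t) v ∸ C) ⟨
    sumF (λ v → Δ G d° s x t c v + (x (suc t) v ∸ C))
      ≤⟨ sumF-mono (node-drop t) ⟩
    sumF (λ v → loopExcess t v + inExcess t v)
      ≡⟨ received≡sent t ⟩
    sumF (outExcess t)
      ≡⟨ sumF-cong (outExcess≡ t) ⟩
    sumF (λ u → x t u ∸ C) ∎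
    where open ≤-Reasoning
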